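{- Let $\mathbb{PBZL}^{\ast}$ be the variety of PBZ*-lattices, let $V(\mathbb{AOL})$ be the variety generated by all antiortholattices, and let $\mathbb{OML}$ be the variety of orthomodular lattices, regarded as the subvariety of $\mathbb{PBZL}^{\ast}$ satisfying $x^{\sim}\approx x'$. Then the join $V(\mathbb{AOL})\vee\mathbb{OML}$, taken in the lattice of subvarieties of $\mathbb{PBZL}^{\ast}$, is a proper subvariety of $\mathbb{PBZL}^{\ast}$.
   Context: A bounded involution lattice $\langle L,\wedge,\vee,',0,1\rangle$ is a bounded lattice with an order-reversing involution $'$. It is a pseudo-Kleene algebra if $a\wedge a'\leq b\vee b'$ for all $a,b$. A BZ-lattice is an algebra $\langle B,\wedge,\vee,',^{\sim},0,1\rangle$ of type $(2,2,1,1,0,0)$ whose $^{\sim}$-free reduct is a pseudo-Kleene algebra and which satisfies, for all $a,b$: $a\wedge a^{\sim}=0$; $a\leq a^{\sim\sim}$; $a\leq b$ implies $b^{\sim}\leq a^{\sim}$; $a^{\sim\prime}=a^{\sim\sim}$. Write $\Diamond x=x^{\sim\sim}$ and $\Box x=x'^{\sim}$. A PBZ*-lattice is a BZ-lattice satisfying, for all $a,b$: $(a\wedge a')^{\sim}\leq a^{\sim}\vee a'^{\sim}$ and $(a^{\sim}\vee(\Diamond a\wedge\Diamond b))\wedge\Diamond a\leq\Diamond b$. An element $a$ is Kleene-sharp if $a\wedge a'=0$. An antiortholattice is a PBZ*-lattice whose only Kleene-sharp elements are $0$ and $1$. An orthomodular lattice is a bounded involution lattice with $a\wedge a'=0$ for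 all $a$ and such that $a\leq b$ implies $b=(b\wedge a')\vee a$. -}

module Defs where

open import Data.Nat using (ℕ)
open import Data.Sum using (_⊎_)
open import Relation.Binary.PropositionalEquality using (_≡_)

record BZSig : Set₁ where
  field
    Carrier : Set
    _∧_ _∨_ : Carrier → Carrier → Carrier
    _′ _~ : Carrier → Carrier
    𝟘 𝟙 : Carrier

  infixr 7 _∧_
  infixr 6 _∨_
  infix 8 _′ _~
  infix 4 _≤_

  _≤_ : Carrier → Carrier → Set
  a ≤ b = a ∧ b ≡ a

  ◇ : Carrier → Carrier
  ◇ x = (x ~) ~

  □ : Carrier → Carrier
  □ x = (x ′) ~

module _ (A : BZSig) where
  open BZSig A

  record IsBoundedInvolutionLattice : Set where
    field
      ∧-comm : ∀ a b → a ∧ b ≡ b ∧ a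
      ∨-comm : ∀ a b → a ∨ b ≡ b ∨ a
      ∧-assoc : ∀ a b c → (a ∧ b) ∧ c ≡ a ∧ (b ∧ c)
      ∨-assoc : ∀ a b c → (a ∨ b) ∨ c ≡ a ∨ (b ∨ c)
      ∧-absorbs-∨ : ∀ a b → a ∧ (a ∨ b) ≡ a
      ∨-absorbs-∧ : ∀ a b → a ∨ (a ∧ b) ≡ a
      𝟘-bottom : ∀ a → 𝟘 ≤ a
      𝟙-top : ∀ a → a ≤ 𝟙
      ′-involutive : ∀ a → (a ′) ′ ≡ a
      ′-antitone : ∀ a b → a ≤ b → b ′ ≤ a ′

  record IsPseudoKleene : Set where
    field
      isBIL : IsBoundedInvolutionLattice
      kleene : ∀ a b → a ∧ a ′ ≤ b ∨ b ′

  record IsBZLattice : Set where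
    field
      isPK : IsPseudoKleene
      ~-contra : ∀ a → a ∧ a ~ ≡ 𝟘
      ~~-expansive : ∀ a → a ≤ (a ~) ~
      ~-antitone : ∀ a b → a ≤ b → b ~ ≤ a ~
      ~′ : ∀ a → (a ~) ′ ≡ (a ~) ~

  record IsPBZ*Lattice : Set where
    field
      isBZ : IsBZLattice
      star : ∀ a → (a ∧ a ′) ~ ≤ a ~ ∨ (a ′) ~
      paraorthomodular : ∀ a b →
        (a ~ ∨ (◇ a ∧ ◇ b)) ∧ ◇ a ≤ ◇ b

  KleeneSharp : Carrier → Set
  KleeneSharp a = a ∧ a ′ ≡ 𝟘

  record IsAntiortholattice : Set where
    field
      isPBZ* : IsPBZ*Lattice
      sharp-trivial : ∀ a → KleeneSharp a → (a ≡ 𝟘) ⊎ (a ≡ 𝟙)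

  record IsOMLinPBZ* : Set where
    field
      isPBZ* : IsPBZ*Lattice
      ~≡′ : ∀ a → a ~ ≡ a ′

data Term : Set where
  var : ℕ → Term
  _∧ₜ_ _∨ₜ_ : Term → Term → Term
  _′ₜ _~ₜ : Term → Term
  𝟘ₜ 𝟙ₜ : Term

eval : (A : BZSig) → (ℕ → BZSig.Carrier A) → Term → BZSig.Carrier A
eval A ρ (var i) = ρ i
eval A ρ (s ∧ₜ t) = BZSig._∧_ A (eval A ρ s) (eval A ρ t)
eval A ρ (s ∨ₜ t) = BZSig._∨_ A (eval A ρ s) (eval A ρ t)
eval A ρ (s ′ₜ) = BZSig._′ A (eval A ρ s)
eval A ρ (s ~ₜ) = BZSig._~ A (eval A ρ s)
eval A ρ 𝟘ₜ = BZSig.𝟘 A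
eval A ρ 𝟙ₜ = BZSig.𝟙 A

_⊨_≈_ : BZSig → Term → Term → Set
A ⊨ s ≈ t = ∀ (ρ : ℕ → BZSig.Carrier A) → eval A ρ s ≡ eval A ρ t

-- identity valid in every antiortholattice (hence in V(AOL))
ValidInAOL : Term → Term → Set₁
ValidInAOL s t = ∀ (A : BZSig) → IsAntiortholattice A → A ⊨ s ≈ t

ValidInOML : Term → Term → Set₁
ValidInOML s t = ∀ (A : BZSig) → IsOMLinPBZ* A → A ⊨ s ≈ t

-- Membership in the join V(AOL) ∨ OML in the lattice of subvarieties:
-- the variety axiomatised by the identities valid in both V(AOL) and OML.
InJoinAOL-OML : BZSig → Set₁
InJoinAOL-OML A = ∀ (s t : Term) → ValidInAOL s t → ValidInOML s t → A ⊨ s ≈ t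

module Submission where

-- The join is axiomatised by the identities valid both in every
-- antiortholattice and in every orthomodular lattice, so it suffices to
-- exhibit one such identity and a PBZ*-lattice in which it fails.  The
-- identity is
--     y~ ∧ ◇(x ∧ x′)  ≈  ◇(y~ ∧ (x ∧ x′)).
-- It holds in every antiortholattice because y~ is Kleene-sharp, hence 0
-- or 1, and both 0 and 1 commute with ◇ under meets; it holds in every
-- orthomodular lattice because there x ∧ x′ = 0 and both sides collapse to 0.
-- It fails in the five-element PBZ*-lattice obtained as the horizontal sum
-- of the four-element Boolean algebra {0, p, q, 1} and the three-element
-- antiortholattice {0, c, 1}: at x = c, y = q the left side is p and the
-- right side is 0.

open import Defs
open import Data.Product using (Σ; _×_; _,_)
open import Data.Nat using (ℕ; zero; suc)
open import Data.Fin using (Fin; zero; suc)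
open import Data.Fin.Properties using (_≟_; all?)
open import Data.Sum using (inj₁; inj₂)
open import Relation.Nullary using (¬_; Dec)
open import Relation.Nullary.Decidable using (True; toWitness; _→-dec_)
open import Relation.Binary.PropositionalEquality using (_≡_; refl; sym; trans; cong)

module BZLatticeFacts (A : BZSig) (bz : IsBZLattice A) where
  open BZSig A
  open IsBZLattice bz
  open IsPseudoKleene isPK
  open IsBoundedInvolutionLattice isBIL

  𝟙∧ : ∀ w → 𝟙 ∧ w ≡ w
  𝟙∧ w = trans (∧-comm 𝟙 w) (𝟙-top w)

  ∧𝟘 : ∀ w → w ∧ 𝟘 ≡ 𝟘
  ∧𝟘 w = trans (∧-comm w 𝟘) (𝟘-bottom w)

  𝟙~ : 𝟙 ~ ≡ 𝟘
  𝟙~ = trans (sym (𝟙∧ (𝟙 ~))) (~-contra 𝟙)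

  𝟘~ : 𝟘 ~ ≡ 𝟙
  𝟘~ = trans (sym (𝟙∧ (𝟘 ~)))
             (trans (cong (λ z → 𝟙 ∧ z ~) (sym 𝟙~)) (~~-expansive 𝟙))

  ◇𝟘 : ◇ 𝟘 ≡ 𝟘
  ◇𝟘 = trans (cong _~ 𝟘~) 𝟙~

  -- Every Brouwer complement is Kleene-sharp, since z~′ = z~~.
  ~-sharp : ∀ z → KleeneSharp A (z ~)
  ~-sharp z = trans (cong (z ~ ∧_) (~′ z)) (~-contra (z ~))

  ◇-commute-at-𝟘 : ∀ Z {W} → W ≡ 𝟘 → Z ∧ ◇ W ≡ ◇ (Z ∧ W)
  ◇-commute-at-𝟘 Z refl =
    trans (cong (Z ∧_) ◇𝟘) (trans (∧𝟘 Z) (sym (trans (cong ◇ (∧𝟘 Z)) ◇𝟘)))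

-- In an antiortholattice, meeting with a Kleene-sharp element commutes with ◇:
-- such an element is 0 or 1, and both bounds commute with ◇ under meets.
module AntiortholatticeFacts (A : BZSig) (aol : IsAntiortholattice A) where
  open BZSig A
  open IsAntiortholattice aol
  open IsPBZ*Lattice isPBZ*
  open BZLatticeFacts A isBZ
  open IsBoundedInvolutionLattice
    (IsPseudoKleene.isBIL (IsBZLattice.isPK isBZ)) using (𝟘-bottom)

  sharp-◇-commute : ∀ {Z} W → KleeneSharp A Z → Z ∧ ◇ W ≡ ◇ (Z ∧ W)
  sharp-◇-commute {Z} W sharp with sharp-trivial Z sharp
  ... | inj₁ refl = trans (𝟘-bottom (◇ W)) (sym (trans (cong ◇ (𝟘-bottom W)) ◇𝟘))
  ... | inj₂ refl = trans (𝟙∧ (◇ W)) (sym (cong ◇ (𝟙∧ W)))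

-- In an orthomodular lattice every element is Kleene-sharp, as x′ = x~.
orthocomplement-disjoint : ∀ A → (oml : IsOMLinPBZ* A) → ∀ x → KleeneSharp A x
orthocomplement-disjoint A oml x =
  trans (cong (x ∧_) (sym (~≡′ x))) (~-contra x)
  where
  open BZSig A
  open IsOMLinPBZ* oml
  open IsBZLattice (IsPBZ*Lattice.isBZ isPBZ*)

excluded-from-join : ∀ A s t → ValidInAOL s t → ValidInOML s t →
                     ¬ (A ⊨ s ≈ t) → ¬ InJoinAOL-OML A
excluded-from-join A s t aol oml fails inJoin = fails (inJoin s t aol oml)

◇ₜ : Term → Term
◇ₜ t = (t ~ₜ) ~ₜ

separatingˡ separatingʳ : Term
separatingˡ = (var 1 ~ₜ) ∧ₜ ◇ₜ (var 0 ∧ₜ (var 0 ′ₜ))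
separatingʳ = ◇ₜ ((var 1 ~ₜ) ∧ₜ (var 0 ∧ₜ (var 0 ′ₜ)))

separating-valid-AOL : ValidInAOL separatingˡ separatingʳ
separating-valid-AOL A aol ρ =
  sharp-◇-commute _ (~-sharp (ρ 1))
  where
  open AntiortholatticeFacts A aol
  open BZLatticeFacts A (IsPBZ*Lattice.isBZ (IsAntiortholattice.isPBZ* aol))

separating-valid-OML : ValidInOML separatingˡ separatingʳ
separating-valid-OML A oml ρ =
  ◇-commute-at-𝟘 (BZSig._~ A (ρ 1)) (orthocomplement-disjoint A oml (ρ 0))
  where open BZLatticeFacts A (IsPBZ*Lattice.isBZ (IsOMLinPBZ*.isPBZ* oml))

-- The five-element model: the lattice M₃ with atoms p, q, c; the involution
-- swaps p and q and fixes c; the Brouwer complement agrees with ′ on the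
-- Boolean block {0, p, q, 1} and sends the non-sharp atom c to 0.
-- Using Fin 5 as carrier makes equality, and hence every law, decidable.
M : Set
M = Fin 5

pattern o = zero
pattern p = suc zero
pattern q = suc (suc zero)
pattern c = suc (suc (suc zero))
pattern i = suc (suc (suc (suc zero)))

_⊓_ _⊔_ : M → M → M
o ⊓ _ = o
i ⊓ b = b
_ ⊓ o = o
a ⊓ i = a
p ⊓ p = p
q ⊓ q = q
c ⊓ c = c
_ ⊓ _ = o

i ⊔ _ = i
o ⊔ b = b
_ ⊔ i = i
a ⊔ o = a
p ⊔ p = p
q ⊔ q = q
c ⊔ c = c
_ ⊔ _ = i

neg brouwer : M → M
neg o = i
neg p = q
neg q = p
neg c = c
neg i = o

brouwer o = i
brouwer p = q
brouwer q = p
brouwer c = o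
brouwer i = o

HorizontalSum : BZSig
HorizontalSum = record
  { Carrier = M ; _∧_ = _⊓_ ; _∨_ = _⊔_ ; _′ = neg ; _~ = brouwer ; 𝟘 = o ; 𝟙 = i }

decide : ∀ {P : Set} (P? : Dec P) → {True P?} → P
decide _ {ok} = toWitness ok

horizontalSum-PBZ* : IsPBZ*Lattice HorizontalSum
horizontalSum-PBZ* = record
  { isBZ = record
    { isPK = record
      { isBIL = record
        { ∧-comm = decide (all? λ a → all? λ b → a ⊓ b ≟ b ⊓ a)
        ; ∨-comm = decide (all? λ a → all? λ b → a ⊔ b ≟ b ⊔ a)
        ; ∧-assoc = decide (all? λ a → all? λ b → all? λ d →
                      (a ⊓ b) ⊓ d ≟ a ⊓ (b ⊓ d))
        ; ∨-assoc = decide (all? λ a → all? λ b → all? λ d →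
                      (a ⊔ b) ⊔ d ≟ a ⊔ (b ⊔ d))
        ; ∧-absorbs-∨ = decide (all? λ a → all? λ b → a ⊓ (a ⊔ b) ≟ a)
        ; ∨-absorbs-∧ = decide (all? λ a → all? λ b → a ⊔ (a ⊓ b) ≟ a)
        ; 𝟘-bottom = decide (all? λ a → o ⊓ a ≟ o)
        ; 𝟙-top = decide (all? λ a → a ⊓ i ≟ a)
        ; ′-involutive = decide (all? λ a → neg (neg a) ≟ a)
        ; ′-antitone = decide (all? λ a → all? λ b →
                         (a ⊓ b ≟ a) →-dec (neg b ⊓ neg a ≟ neg b))
        }
      ; kleene = decide (all? λ a → all? λ b →
                   (a ⊓ neg a) ⊓ (b ⊔ neg b) ≟ a ⊓ neg a)
      }
    ; ~-contra = decide (all? λ a → a ⊓ brouwer a ≟ o)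
    ; ~~-expansive = decide (all? λ a → a ⊓ brouwer (brouwer a) ≟ a)
    ; ~-antitone = decide (all? λ a → all? λ b →
                     (a ⊓ b ≟ a) →-dec (brouwer b ⊓ brouwer a ≟ brouwer b))
    ; ~′ = decide (all? λ a → neg (brouwer a) ≟ brouwer (brouwer a))
    }
  ; star = decide (all? λ a →
      brouwer (a ⊓ neg a) ⊓ (brouwer a ⊔ brouwer (neg a)) ≟ brouwer (a ⊓ neg a))
  ; paraorthomodular = decide (all? λ a → all? λ b →
      let ◇a = brouwer (brouwer a) ; ◇b = brouwer (brouwer b) in
      ((brouwer a ⊔ (◇a ⊓ ◇b)) ⊓ ◇a) ⊓ ◇b ≟ (brouwer a ⊔ (◇a ⊓ ◇b)) ⊓ ◇a)
  }

-- At x = c, y = q the separating identity evaluates to p ≈ 0.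
counterexample : ℕ → M
counterexample zero = c
counterexample (suc _) = q

separating-fails : ¬ (HorizontalSum ⊨ separatingˡ ≈ separatingʳ)
separating-fails holds with holds counterexample
... | ()

mainTheorem1 : Σ BZSig (λ A → IsPBZ*Lattice A × ¬ InJoinAOL-OML A)
mainTheorem1 =
  HorizontalSum ,
  horizontalSum-PBZ* ,
  excluded-from-join HorizontalSum separatingˡ separatingʳ
    separating-valid-AOL separating-valid-OML separating-fails
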